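{- Let $p_2>3$ be a prime. For every integer $i$ with $1\le i\le p_2-2$, \[\mathcal{T}_{i+1}\Phi_{3p_2}=\begin{cases}(1-x)\sum_{j=0}^{\lfloor (i-1)/3\rfloor}x^{3j}+x^{i}, & \text{if } i\equiv 0 \pmod 3,\\ (1-x)\sum_{j=0}^{\lfloor i/3\rfloor}x^{3j}, & \text{if } i\equiv 1,2 \pmod 3.\end{cases}\]
   Context: $\Phi_n$ is the $n$-th cyclotomic polynomial. For a polynomial $f$, $\mathcal{T}_sf=\mathrm{rem}(f,x^s)$, the truncation of $f$ keeping only the terms of degree less than $s$. -}

module Defs where

open import Data.Nat using (ℕ; zero; suc; _∸_; _<ᵇ_)
import Data.Nat as N
open import Data.Nat.Divisibility using (_∣?_)
open import Data.Integer using (ℤ; +_; -_; _+_; _*_; _-_)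
open import Data.List using (List; []; _∷_; _++_; replicate; reverse; length; foldr; take; upTo; filterᵇ)
open import Data.Bool using (Bool; true; false; if_then_else_)
open import Relation.Nullary using (does)
open import Relation.Binary.PropositionalEquality using (_≡_)

-- Polynomials over ℤ as little-endian coefficient lists
-- (the list a₀ ∷ a₁ ∷ … represents a₀ + a₁ x + …; trailing zeros allowed).

Poly : Set
Poly = List ℤ

coeff : Poly → ℕ → ℤ
coeff []       _       = + 0
coeff (a ∷ f)  zero    = a
coeff (a ∷ f)  (suc k) = coeff f k

infix 4 _≈ₚ_
_≈ₚ_ : Poly → Poly → Set
f ≈ₚ g = ∀ k → coeff f k ≡ coeff g k

infixl 6 _⊕_ _⊖_
infixl 7 _⊗_

_⊕_ : Poly → Poly → Poly
[]      ⊕ g       = g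
(a ∷ f) ⊕ []      = a ∷ f
(a ∷ f) ⊕ (b ∷ g) = (a + b) ∷ (f ⊕ g)

scale : ℤ → Poly → Poly
scale c []      = []
scale c (a ∷ f) = c * a ∷ scale c f

negP : Poly → Poly
negP = scale (- (+ 1))

_⊖_ : Poly → Poly → Poly
f ⊖ g = f ⊕ negP g

_⊗_ : Poly → Poly → Poly
[]      ⊗ g = []
(a ∷ f) ⊗ g = scale a g ⊕ (+ 0 ∷ (f ⊗ g))

oneP : Poly
oneP = + 1 ∷ []

X^ : ℕ → Poly
X^ n = replicate n (+ 0) ++ (+ 1 ∷ [])

sumTo : ℕ → (ℕ → Poly) → Poly
sumTo zero    f = f 0
sumTo (suc m) f = sumTo m f ⊕ f (suc m)

-- truncation 𝒯_s f = rem(f, x^s): keep the terms of degree < s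
trunc : ℕ → Poly → Poly
trunc s f = take s f

isZero : ℤ → Bool
isZero (+ 0) = true
isZero _     = false

norm : Poly → Poly
norm f = reverse (dropZ (reverse f))
  where
  dropZ : Poly → Poly
  dropZ []      = []
  dropZ (a ∷ g) = if isZero a then dropZ g else a ∷ g

lead : Poly → ℤ
lead f with reverse f
... | []    = + 0
... | a ∷ _ = a

quotF : ℕ → Poly → Poly → Poly
quotF zero     f g = []
quotF (suc n) f g =
  let f' = norm f in
  if length f' <ᵇ length g then []
  else (let t = scale (lead f') (X^ (length f' ∸ length g))
        in t ⊕ quotF n (f' ⊖ (t ⊗ g)) g)

quotMonic : Poly → Poly → Poly
quotMonic f g = quotF (suc (length f)) f (norm g)

-- Cyclotomic polynomials, defined by  x^n - 1 = ∏_{d ∣ n} Φ_d ,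
-- i.e.  Φ_n = (x^n - 1) / ∏_{d ∣ n, d < n} Φ_d   (n ≥ 1).

nth : List Poly → ℕ → Poly
nth []      _       = oneP
nth (f ∷ l) zero    = f
nth (f ∷ l) (suc k) = nth l k

-- table n = [Φ_1, …, Φ_n]
table : ℕ → List Poly
table zero    = []
table (suc n) = table n ++ (new ∷ [])
  where
  m = suc n
  properDivs : List ℕ
  properDivs = filterᵇ (λ d → does (d ∣? m)) (Data.List.map suc (upTo n))
  prodΦ : Poly
  prodΦ = foldr (λ d acc → nth (table n) (d ∸ 1) ⊗ acc) oneP properDivs
  new : Poly
  new = quotMonic (X^ m ⊖ oneP) prodΦ

-- Φ n  (Φ 0 is a dummy value 1; only n ≥ 1 is meaningful)
Φ : ℕ → Poly
Φ n = nth (table n) (n ∸ 1)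

{-# OPTIONS --safe #-}
-- Φ₃ₚ is the exact quotient of x^(3p) - 1 by Φ₁ Φ₃ Φₚ, so it equals any Q with Q Φ₁ Φ₃ Φₚ = x^(3p) - 1.
-- As Φ₁ Φₚ = x^p - 1 and (x^p - 1)(1 + x^p + x^(2p)) = x^(3p) - 1, it suffices that Φ₃ Q = 1 + x^p + x^(2p);
-- writing p = a + 3(α + 1) and 2p = b + 3(β + 1) with {a, b} = {1, 2} (possible as p ≢ 0 mod 3),
-- Q = 1 - x^a R_α - x^b R_β works, where R_N = (1 - x)(1 + x³ + ⋯ + x^(3N)) satisfies Φ₃ R_N = 1 - x^(3N+3).
-- As Φ₃ is a unit of ℤ[[x]], this equation forces Q to agree below degree p with
-- 1/Φ₃ = (1 - x)/(1 - x³) = (1 - x)(1 + x³ + x⁶ + ⋯), whose truncations are the two cases of the formula.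
module Submission where

open import Defs
open import Data.List using (List; []; _∷_; _++_; replicate; length; reverse; take)
open import Data.Product using (Σ-syntax; _×_; _,_; proj₁; proj₂)
open import Data.Sum using (_⊎_; inj₁; inj₂)
open import Data.Empty using (⊥-elim)
open import Relation.Nullary using (¬_; yes; no)
open import Relation.Binary.PropositionalEquality

module PolynomialRing where

  open import Data.Nat using (zero; suc)
  open import Data.Integer using (ℤ; +_; _+_; _*_; -_)
  import Data.Integer.Properties as ℤ
  open import Data.Maybe using (Maybe; just; nothing)
  open import Algebra.Bundles using (CommutativeRing)
  open import Relation.Binary.Structures using (IsEquivalence)
  open import Relation.Binary.Bundles using (Setoid)
  open import Tactic.RingSolver.Core.AlmostCommutativeRing
    using (AlmostCommutativeRing; fromCommutativeRing)

  -- _≈ₚ_ wrapped in a record, so that it is injective in its arguments as the ring solver needs.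
  infix 4 _≋_
  record _≋_ (f g : Poly) : Set where
    constructor coeffwise
    field at : f ≈ₚ g
  open _≋_ public

  ≋-refl : ∀ {f} → f ≋ f
  ≋-refl = coeffwise λ _ → refl

  ≋-sym : ∀ {f g} → f ≋ g → g ≋ f
  ≋-sym e = coeffwise λ k → sym (at e k)

  ≋-trans : ∀ {f g h} → f ≋ g → g ≋ h → f ≋ h
  ≋-trans e e′ = coeffwise λ k → trans (at e k) (at e′ k)

  ≡⇒≋ : ∀ {f g} → f ≡ g → f ≋ g
  ≡⇒≋ refl = ≋-refl

  ≋-isEquivalence : IsEquivalence _≋_
  ≋-isEquivalence = record { refl = ≋-refl ; sym = ≋-sym ; trans = ≋-trans }

  ≋-setoid : Setoid _ _
  ≋-setoid = record { isEquivalence = ≋-isEquivalence }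

  ∷-cong : ∀ {a b f g} → a ≡ b → f ≋ g → (a ∷ f) ≋ (b ∷ g)
  ∷-cong a≡b f≋g = coeffwise λ { zero → a≡b ; (suc k) → at f≋g k }

  ∷-injectiveʳ : ∀ {a b f g} → (a ∷ f) ≋ (b ∷ g) → f ≋ g
  ∷-injectiveʳ e = coeffwise λ k → at e (suc k)

  shift : Poly → Poly
  shift f = + 0 ∷ f

  shift-[] : shift [] ≋ []
  shift-[] = coeffwise λ { zero → refl ; (suc k) → refl }

  shift-cong : ∀ {f g} → f ≋ g → shift f ≋ shift g
  shift-cong = ∷-cong refl

  coeff-⊕ : ∀ f g k → coeff (f ⊕ g) k ≡ coeff f k + coeff g k
  coeff-⊕ []      g       k       = sym (ℤ.+-identityˡ _)
  coeff-⊕ (a ∷ f) []      k       = sym (ℤ.+-identityʳ _)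
  coeff-⊕ (a ∷ f) (b ∷ g) zero    = refl
  coeff-⊕ (a ∷ f) (b ∷ g) (suc k) = coeff-⊕ f g k

  coeff-scale : ∀ c f k → coeff (scale c f) k ≡ c * coeff f k
  coeff-scale c []      k       = sym (ℤ.*-zeroʳ c)
  coeff-scale c (a ∷ f) zero    = refl
  coeff-scale c (a ∷ f) (suc k) = coeff-scale c f k

  coeff-negP : ∀ f k → coeff (negP f) k ≡ - coeff f k
  coeff-negP f k = trans (coeff-scale _ f k) (ℤ.-1*i≡-i _)

  ⊕-cong : ∀ {f f′ g g′} → f ≋ f′ → g ≋ g′ → (f ⊕ g) ≋ (f′ ⊕ g′)
  ⊕-cong {f} {f′} {g} {g′} e e′ = coeffwise λ k →
    trans (coeff-⊕ f g k) (trans (cong₂ _+_ (at e k) (at e′ k)) (sym (coeff-⊕ f′ g′ k)))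

  ⊕-assoc : ∀ f g h → ((f ⊕ g) ⊕ h) ≋ (f ⊕ (g ⊕ h))
  ⊕-assoc f g h = coeffwise λ k → begin
    coeff ((f ⊕ g) ⊕ h) k                ≡⟨ coeff-⊕ (f ⊕ g) h k ⟩
    coeff (f ⊕ g) k + coeff h k          ≡⟨ cong (_+ coeff h k) (coeff-⊕ f g k) ⟩
    coeff f k + coeff g k + coeff h k    ≡⟨ ℤ.+-assoc (coeff f k) _ _ ⟩
    coeff f k + (coeff g k + coeff h k)  ≡⟨ cong (_+_ (coeff f k)) (coeff-⊕ g h k) ⟨
    coeff f k + coeff (g ⊕ h) k          ≡⟨ coeff-⊕ f (g ⊕ h) k ⟨
    coeff (f ⊕ (g ⊕ h)) k                ∎
    where open ≡-Reasoning

  ⊕-comm : ∀ f g → (f ⊕ g) ≋ (g ⊕ f)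
  ⊕-comm f g = coeffwise λ k →
    trans (coeff-⊕ f g k) (trans (ℤ.+-comm (coeff f k) _) (sym (coeff-⊕ g f k)))

  ⊕-identityʳ : ∀ f → (f ⊕ []) ≋ f
  ⊕-identityʳ f = coeffwise λ k → trans (coeff-⊕ f [] k) (ℤ.+-identityʳ _)

  ⊕-inverseʳ : ∀ f → (f ⊕ negP f) ≋ []
  ⊕-inverseʳ f = coeffwise λ k →
    trans (coeff-⊕ f (negP f) k) (trans (cong (_+_ (coeff f k)) (coeff-negP f k)) (ℤ.+-inverseʳ (coeff f k)))

  ⊕-interchange : ∀ f g h l → ((f ⊕ g) ⊕ (h ⊕ l)) ≋ ((f ⊕ h) ⊕ (g ⊕ l))
  ⊕-interchange f g h l = begin
    (f ⊕ g) ⊕ (h ⊕ l)  ≈⟨ ⊕-assoc f g (h ⊕ l) ⟩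
    f ⊕ (g ⊕ (h ⊕ l))  ≈⟨ ⊕-cong (≋-refl {f}) (≋-sym (⊕-assoc g h l)) ⟩
    f ⊕ ((g ⊕ h) ⊕ l)  ≈⟨ ⊕-cong (≋-refl {f}) (⊕-cong (⊕-comm g h) (≋-refl {l})) ⟩
    f ⊕ ((h ⊕ g) ⊕ l)  ≈⟨ ⊕-cong (≋-refl {f}) (⊕-assoc h g l) ⟩
    f ⊕ (h ⊕ (g ⊕ l))  ≈⟨ ≋-sym (⊕-assoc f h (g ⊕ l)) ⟩
    (f ⊕ h) ⊕ (g ⊕ l)  ∎
    where open import Relation.Binary.Reasoning.Setoid ≋-setoid

  scale-cong : ∀ {c f g} → f ≋ g → scale c f ≋ scale c g
  scale-cong {c} {f} {g} e = coeffwise λ k →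
    trans (coeff-scale c f k) (trans (cong (c *_) (at e k)) (sym (coeff-scale c g k)))

  ⊖-cong : ∀ {f f′ g g′} → f ≋ f′ → g ≋ g′ → (f ⊖ g) ≋ (f′ ⊖ g′)
  ⊖-cong e e′ = ⊕-cong e (scale-cong e′)

  scale-congˡ : ∀ {a b} f → a ≡ b → scale a f ≋ scale b f
  scale-congˡ f refl = ≋-refl

  scale-distribˡ : ∀ c f g → scale c (f ⊕ g) ≋ (scale c f ⊕ scale c g)
  scale-distribˡ c f g = coeffwise λ k → begin
    coeff (scale c (f ⊕ g)) k                  ≡⟨ coeff-scale c (f ⊕ g) k ⟩
    c * coeff (f ⊕ g) k                        ≡⟨ cong (c *_) (coeff-⊕ f g k) ⟩
    c * (coeff f k + coeff g k)                ≡⟨ ℤ.*-distribˡ-+ c (coeff f k) _ ⟩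
    c * coeff f k + c * coeff g k              ≡⟨ cong₂ _+_ (coeff-scale c f k) (coeff-scale c g k) ⟨
    coeff (scale c f) k + coeff (scale c g) k  ≡⟨ coeff-⊕ (scale c f) (scale c g) k ⟨
    coeff (scale c f ⊕ scale c g) k            ∎
    where open ≡-Reasoning

  scale-distribʳ : ∀ a b f → scale (a + b) f ≋ (scale a f ⊕ scale b f)
  scale-distribʳ a b f = coeffwise λ k → begin
    coeff (scale (a + b) f) k                  ≡⟨ coeff-scale (a + b) f k ⟩
    (a + b) * coeff f k                        ≡⟨ ℤ.*-distribʳ-+ (coeff f k) a b ⟩
    a * coeff f k + b * coeff f k              ≡⟨ cong₂ _+_ (coeff-scale a f k) (coeff-scale b f k) ⟨
    coeff (scale a f) k + coeff (scale b f) k  ≡⟨ coeff-⊕ (scale a f) (scale b f) k ⟨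
    coeff (scale a f ⊕ scale b f) k            ∎
    where open ≡-Reasoning

  scale-scale : ∀ a b f → scale a (scale b f) ≋ scale (a * b) f
  scale-scale a b f = coeffwise λ k →
    trans (coeff-scale a (scale b f) k)
      (trans (cong (a *_) (coeff-scale b f k)) (trans (sym (ℤ.*-assoc a b _)) (sym (coeff-scale _ f k))))

  scale-comm : ∀ a b f → scale a (scale b f) ≋ scale b (scale a f)
  scale-comm a b f =
    ≋-trans (scale-scale a b f) (≋-trans (scale-congˡ f (ℤ.*-comm a b)) (≋-sym (scale-scale b a f)))

  scale-zero : ∀ f → scale (+ 0) f ≋ []
  scale-zero f = coeffwise (coeff-scale (+ 0) f)

  scale-one : ∀ f → scale (+ 1) f ≋ f
  scale-one f = coeffwise λ k → trans (coeff-scale (+ 1) f k) (ℤ.*-identityˡ _)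

  scale-shift : ∀ c f → scale c (shift f) ≋ shift (scale c f)
  scale-shift c f = ∷-cong (ℤ.*-zeroʳ c) ≋-refl

  ⊗-zeroʳ : ∀ f → (f ⊗ []) ≋ []
  ⊗-zeroʳ []      = ≋-refl
  ⊗-zeroʳ (a ∷ f) = ≋-trans (shift-cong (⊗-zeroʳ f)) shift-[]

  ⊗-zeroˡ : ∀ {f} g → f ≋ [] → (f ⊗ g) ≋ []
  ⊗-zeroˡ {[]}    g e = ≋-refl
  ⊗-zeroˡ {a ∷ f} g e =
    ≋-trans (⊕-cong (≋-trans (scale-congˡ g (at e zero)) (scale-zero g)) (shift-cong (⊗-zeroˡ {f} g (coeffwise λ k → at e (suc k)))))
            shift-[]

  ⊗-congˡ : ∀ {f f′} g → f ≋ f′ → (f ⊗ g) ≋ (f′ ⊗ g)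
  ⊗-congˡ {[]}    g e = ≋-sym (⊗-zeroˡ g (≋-sym e))
  ⊗-congˡ {a ∷ f} {[]} g e = ⊗-zeroˡ g e
  ⊗-congˡ {a ∷ f} {b ∷ f′} g e = ⊕-cong (scale-congˡ g (at e zero)) (shift-cong (⊗-congˡ g (∷-injectiveʳ e)))

  ⊗-congʳ : ∀ f {g g′} → g ≋ g′ → (f ⊗ g) ≋ (f ⊗ g′)
  ⊗-congʳ []      e = ≋-refl
  ⊗-congʳ (a ∷ f) e = ⊕-cong (scale-cong e) (shift-cong (⊗-congʳ f e))

  ⊗-cong : ∀ {f f′ g g′} → f ≋ f′ → g ≋ g′ → (f ⊗ g) ≋ (f′ ⊗ g′)
  ⊗-cong {f} {f′} {g} e e′ = ≋-trans (⊗-congˡ g e) (⊗-congʳ f′ e′)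

  ⊗-distribʳ : ∀ f f′ g → ((f ⊕ f′) ⊗ g) ≋ ((f ⊗ g) ⊕ (f′ ⊗ g))
  ⊗-distribʳ []      f′       g = ≋-refl
  ⊗-distribʳ (a ∷ f) []       g = ≋-sym (⊕-identityʳ _)
  ⊗-distribʳ (a ∷ f) (b ∷ f′) g =
    ≋-trans (⊕-cong (scale-distribʳ a b g) (shift-cong (⊗-distribʳ f f′ g)))
            (⊕-interchange (scale a g) (scale b g) (shift (f ⊗ g)) (shift (f′ ⊗ g)))

  ⊗-distribˡ : ∀ f g g′ → (f ⊗ (g ⊕ g′)) ≋ ((f ⊗ g) ⊕ (f ⊗ g′))
  ⊗-distribˡ []      g g′ = ≋-refl
  ⊗-distribˡ (a ∷ f) g g′ =
    ≋-trans (⊕-cong (scale-distribˡ a g g′) (shift-cong (⊗-distribˡ f g g′)))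
            (⊕-interchange (scale a g) (scale a g′) (shift (f ⊗ g)) (shift (f ⊗ g′)))

  scale-⊗ˡ : ∀ c f g → (scale c f ⊗ g) ≋ scale c (f ⊗ g)
  scale-⊗ˡ c []      g = ≋-refl
  scale-⊗ˡ c (a ∷ f) g =
    ≋-trans (⊕-cong (≋-sym (scale-scale c a g)) (shift-cong (scale-⊗ˡ c f g)))
            (≋-sym (≋-trans (scale-distribˡ c (scale a g) (shift (f ⊗ g))) (⊕-cong ≋-refl (scale-shift c (f ⊗ g)))))

  scale-⊗ʳ : ∀ c f g → (f ⊗ scale c g) ≋ scale c (f ⊗ g)
  scale-⊗ʳ c []      g = ≋-refl
  scale-⊗ʳ c (a ∷ f) g =
    ≋-trans (⊕-cong (scale-comm a c g) (shift-cong (scale-⊗ʳ c f g)))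
            (≋-sym (≋-trans (scale-distribˡ c (scale a g) (shift (f ⊗ g))) (⊕-cong ≋-refl (scale-shift c (f ⊗ g)))))

  shift-⊗ˡ : ∀ f g → (shift f ⊗ g) ≋ shift (f ⊗ g)
  shift-⊗ˡ f g = ⊕-cong (scale-zero g) ≋-refl

  shift-⊗ʳ : ∀ f g → (f ⊗ shift g) ≋ shift (f ⊗ g)
  shift-⊗ʳ []      g = ≋-sym shift-[]
  shift-⊗ʳ (a ∷ f) g = ⊕-cong (scale-shift a g) (shift-cong (shift-⊗ʳ f g))

  ⊗-identityʳ : ∀ f → (f ⊗ oneP) ≋ f
  ⊗-identityʳ []      = ≋-refl
  ⊗-identityʳ (a ∷ f) = ∷-cong (trans (ℤ.+-identityʳ _) (ℤ.*-identityʳ a)) (⊗-identityʳ f)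

  ⊗-identityˡ : ∀ f → (oneP ⊗ f) ≋ f
  ⊗-identityˡ f = ≋-trans (⊕-cong (scale-one f) shift-[]) (⊕-identityʳ f)

  ⊗-constʳ : ∀ f a → (f ⊗ (a ∷ [])) ≋ scale a f
  ⊗-constʳ f a =
    ≋-trans (⊗-congʳ f (∷-cong (sym (ℤ.*-identityʳ a)) ≋-refl))
            (≋-trans (scale-⊗ʳ a f oneP) (scale-cong (⊗-identityʳ f)))

  ⊗-∷ʳ : ∀ f a g → (f ⊗ (a ∷ g)) ≋ (scale a f ⊕ shift (f ⊗ g))
  ⊗-∷ʳ f a g =
    ≋-trans (⊗-congʳ f (∷-cong (sym (ℤ.+-identityʳ a)) ≋-refl))
            (≋-trans (⊗-distribˡ f (a ∷ []) (shift g)) (⊕-cong (⊗-constʳ f a) (shift-⊗ʳ f g)))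

  ⊗-comm : ∀ f g → (f ⊗ g) ≋ (g ⊗ f)
  ⊗-comm []      g = ≋-sym (⊗-zeroʳ g)
  ⊗-comm (a ∷ f) g = ≋-trans (⊕-cong ≋-refl (shift-cong (⊗-comm f g))) (≋-sym (⊗-∷ʳ g a f))

  ⊗-assoc : ∀ f g h → ((f ⊗ g) ⊗ h) ≋ (f ⊗ (g ⊗ h))
  ⊗-assoc []      g h = ≋-refl
  ⊗-assoc (a ∷ f) g h =
    ≋-trans (⊗-distribʳ (scale a g) (shift (f ⊗ g)) h)
            (⊕-cong (scale-⊗ˡ a g h) (≋-trans (shift-⊗ˡ (f ⊗ g) h) (shift-cong (⊗-assoc f g h))))

  ℤ[x] : CommutativeRing _ _
  ℤ[x] = record
    { Carrier = Poly ; _≈_ = _≋_ ; _+_ = _⊕_ ; _*_ = _⊗_ ; -_ = negP ; 0# = [] ; 1# = oneP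
    ; isCommutativeRing = record
      { isRing = record
        { +-isAbelianGroup = record
          { isGroup = record
            { isMonoid = record
              { isSemigroup = record
                { isMagma = record { isEquivalence = ≋-isEquivalence ; ∙-cong = ⊕-cong }
                ; assoc = ⊕-assoc }
              ; identity = (λ _ → ≋-refl) , ⊕-identityʳ }
            ; inverse = (λ f → ≋-trans (⊕-comm (negP f) f) (⊕-inverseʳ f)) , ⊕-inverseʳ
            ; ⁻¹-cong = scale-cong }
          ; comm = ⊕-comm }
        ; *-cong = ⊗-cong
        ; *-assoc = ⊗-assoc
        ; *-identity = ⊗-identityˡ , ⊗-identityʳ
        ; distrib = ⊗-distribˡ , λ h f g → ⊗-distribʳ f g h }
      ; *-comm = ⊗-comm } }

  ≋[]? : ∀ f → Maybe ([] ≋ f)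
  ≋[]? []        = just ≋-refl
  ≋[]? (+ 0 ∷ f) with ≋[]? f
  ... | just e  = just (coeffwise λ { zero → refl ; (suc k) → at e k })
  ... | nothing = nothing
  ≋[]? (_ ∷ f)   = nothing

  ℤ[x]-solver : AlmostCommutativeRing _ _
  ℤ[x]-solver = fromCommutativeRing ℤ[x] ≋[]?

open PolynomialRing

module Coefficients where

  open import Data.Nat using (ℕ; zero; suc; _≤_; _<_; s≤s)
  import Data.Nat.Properties as ℕ
  open import Data.Integer using (+_; _+_; _*_; -_)
  import Data.Integer.Properties as ℤ

  ZeroFrom : ℕ → Poly → Set
  ZeroFrom m f = ∀ k → m ≤ k → coeff f k ≡ + 0

  ZeroBelow : ℕ → Poly → Set
  ZeroBelow m f = ∀ k → k < m → coeff f k ≡ + 0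

  zeroFrom-length : ∀ f → ZeroFrom (length f) f
  zeroFrom-length []      k       _         = refl
  zeroFrom-length (a ∷ f) (suc k) (s≤s l≤k) = zeroFrom-length f k l≤k

  zeroFrom-resp-≋ : ∀ {m f g} → f ≋ g → ZeroFrom m f → ZeroFrom m g
  zeroFrom-resp-≋ f≋g z k m≤k = trans (sym (at f≋g k)) (z k m≤k)

  zeroFrom-mono : ∀ {m n} f → m ≤ n → ZeroFrom m f → ZeroFrom n f
  zeroFrom-mono f m≤n z k n≤k = z k (ℕ.≤-trans m≤n n≤k)

  zeroFrom-⊕ : ∀ {m} f g → ZeroFrom m f → ZeroFrom m g → ZeroFrom m (f ⊕ g)
  zeroFrom-⊕ f g zf zg k m≤k = trans (coeff-⊕ f g k) (cong₂ _+_ (zf k m≤k) (zg k m≤k))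

  zeroFrom-negP : ∀ {m} f → ZeroFrom m f → ZeroFrom m (negP f)
  zeroFrom-negP f z k m≤k = trans (coeff-negP f k) (cong -_ (z k m≤k))

  zeroFrom-shift : ∀ {m} f → ZeroFrom m f → ZeroFrom (suc m) (shift f)
  zeroFrom-shift f z (suc k) (s≤s m≤k) = z k m≤k

  zeroFrom-X^ : ∀ n → ZeroFrom (suc n) (X^ n)
  zeroFrom-X^ zero    (suc k) _         = refl
  zeroFrom-X^ (suc n) (suc k) (s≤s n<k) = zeroFrom-X^ n k n<k

  zeroBelow-resp-≋ : ∀ {m f g} → f ≋ g → ZeroBelow m f → ZeroBelow m g
  zeroBelow-resp-≋ f≋g z k k<m = trans (sym (at f≋g k)) (z k k<m)

  zeroBelow-mono : ∀ {m n} f → n ≤ m → ZeroBelow m f → ZeroBelow n f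
  zeroBelow-mono f n≤m z k k<n = z k (ℕ.<-≤-trans k<n n≤m)

  zeroBelow-⊕ : ∀ {m} f g → ZeroBelow m f → ZeroBelow m g → ZeroBelow m (f ⊕ g)
  zeroBelow-⊕ f g zf zg k k<m = trans (coeff-⊕ f g k) (cong₂ _+_ (zf k k<m) (zg k k<m))

  zeroBelow-negP : ∀ {m} f → ZeroBelow m f → ZeroBelow m (negP f)
  zeroBelow-negP f z k k<m = trans (coeff-negP f k) (cong -_ (z k k<m))

  zeroBelow-shift : ∀ {m} f → ZeroBelow m f → ZeroBelow (suc m) (shift f)
  zeroBelow-shift f z zero    _         = refl
  zeroBelow-shift f z (suc k) (s≤s k<m) = z k k<m

  zeroBelow-X^ : ∀ n → ZeroBelow n (X^ n)
  zeroBelow-X^ (suc n) zero    _         = refl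
  zeroBelow-X^ (suc n) (suc k) (s≤s k<n) = zeroBelow-X^ n k k<n

  coeff-∷⊗ : ∀ a f g k → coeff ((a ∷ f) ⊗ g) k ≡ a * coeff g k + coeff (shift (f ⊗ g)) k
  coeff-∷⊗ a f g k = trans (coeff-⊕ (scale a g) _ k) (cong (_+ coeff (shift (f ⊗ g)) k) (coeff-scale a g k))

  zeroBelow-⊗ʳ : ∀ {m} f g → ZeroBelow m g → ZeroBelow m (f ⊗ g)
  zeroBelow-⊗ʳ []      g z k k<m = refl
  zeroBelow-⊗ʳ (a ∷ f) g z k k<m = trans (coeff-∷⊗ a f g k) (cong₂ _+_
    (trans (cong (a *_) (z k k<m)) (ℤ.*-zeroʳ a))
    (zeroBelow-shift (f ⊗ g) (zeroBelow-⊗ʳ f g z) k (ℕ.m≤n⇒m≤1+n k<m)))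

  zeroBelow-suc : ∀ {m} g → ZeroBelow m g → coeff g m ≡ + 0 → ZeroBelow (suc m) g
  zeroBelow-suc g z zm k k<1+m with ℕ.m<1+n⇒m<n∨m≡n k<1+m
  ... | inj₁ k<m  = z k k<m
  ... | inj₂ refl = zm

  -- A factor with constant term 1 is a unit of ℤ[[x]], so it cannot create low-order zeros.
  zeroBelow-cancelˡ : ∀ m f g → ZeroBelow m ((+ 1 ∷ f) ⊗ g) → ZeroBelow m g
  zeroBelow-cancelˡ zero    f g z k ()
  zeroBelow-cancelˡ (suc m) f g z = zeroBelow-suc g below (begin
    coeff g m                                  ≡⟨ trans (ℤ.+-identityʳ _) (ℤ.*-identityˡ _) ⟨
    + 1 * coeff g m + + 0                      ≡⟨ cong (_+_ (+ 1 * coeff g m)) shifted≡0 ⟨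
    + 1 * coeff g m + coeff (shift (f ⊗ g)) m  ≡⟨ coeff-∷⊗ (+ 1) f g m ⟨
    coeff ((+ 1 ∷ f) ⊗ g) m                    ≡⟨ z m (ℕ.n<1+n m) ⟩
    + 0                                        ∎)
    where
    open ≡-Reasoning
    below : ZeroBelow m g
    below = zeroBelow-cancelˡ m f g (zeroBelow-mono ((+ 1 ∷ f) ⊗ g) (ℕ.n≤1+n m) z)
    shifted≡0 : coeff (shift (f ⊗ g)) m ≡ + 0
    shifted≡0 = zeroBelow-shift (f ⊗ g) (zeroBelow-⊗ʳ f g below) m (ℕ.n<1+n m)

  coeff-X^-self : ∀ n → coeff (X^ n) n ≡ + 1
  coeff-X^-self zero    = refl
  coeff-X^-self (suc n) = coeff-X^-self n

  Monic : ℕ → Poly → Set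
  Monic d f = coeff f d ≡ + 1 × ZeroFrom (suc d) f

  monic-resp-≋ : ∀ {d f g} → f ≋ g → Monic d f → Monic d g
  monic-resp-≋ {d} f≋g (lead≡1 , z) = trans (sym (at f≋g d)) lead≡1 , zeroFrom-resp-≋ f≋g z

  monic-X^⊕ : ∀ d r → ZeroFrom d r → Monic d (X^ d ⊕ r)
  monic-X^⊕ d r z =
    trans (coeff-⊕ (X^ d) r d) (trans (cong₂ _+_ (coeff-X^-self d) (z d ℕ.≤-refl)) (ℤ.+-identityʳ _)) ,
    zeroFrom-⊕ (X^ d) r (zeroFrom-X^ d) (zeroFrom-mono r (ℕ.n≤1+n d) z)

  coeff-take< : ∀ s f k → k < s → coeff (take s f) k ≡ coeff f k
  coeff-take< (suc s) []      k       _         = refl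
  coeff-take< (suc s) (a ∷ f) zero    _         = refl
  coeff-take< (suc s) (a ∷ f) (suc k) (s≤s k<s) = coeff-take< s f k k<s

  zeroFrom-take : ∀ s f → ZeroFrom s (take s f)
  zeroFrom-take zero    f       k       _         = refl
  zeroFrom-take (suc s) []      k       _         = refl
  zeroFrom-take (suc s) (a ∷ f) (suc k) (s≤s s≤k) = zeroFrom-take s f k s≤k

  trunc-≈ₚ : ∀ s f g → ZeroBelow s (f ⊖ g) → ZeroFrom s g → trunc s f ≈ₚ g
  trunc-≈ₚ s f g agree z k with k ℕ.<? s
  ... | yes k<s = trans (coeff-take< s f k k<s)
                    (ℤ.i-j≡0⇒i≡j _ _ (trans (cong (_+_ (coeff f k)) (sym (coeff-negP g k)))
                                       (trans (sym (coeff-⊕ f (negP g) k)) (agree k k<s))))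
  ... | no k≮s  = trans (zeroFrom-take s f k (ℕ.≮⇒≥ k≮s)) (sym (z k (ℕ.≮⇒≥ k≮s)))

open Coefficients

module MonicDivision where

  open import Data.Nat as ℕ using (ℕ; zero; suc; _≤_; _<_; _∸_; z≤n; s≤s)
  import Data.Nat.Properties as ℕ
  open import Data.Integer using (ℤ; +_; -[1+_]; _+_; _*_; -_)
  import Data.Integer.Properties as ℤ
  open import Data.List.Properties using (reverse-involutive; unfold-reverse; reverse-++; length-++)
  open import Data.Bool using (T; true; false)
  open import Tactic.RingSolver using (solve-∀)

  length-∷ʳ : ∀ h (a : ℤ) → length (h ++ a ∷ []) ≡ suc (length h)
  length-∷ʳ h a = trans (length-++ h) (ℕ.+-comm (length h) 1)

  coeff-++ʳ : ∀ h g j → coeff (h ++ g) (length h ℕ.+ j) ≡ coeff g j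
  coeff-++ʳ []      g j = refl
  coeff-++ʳ (a ∷ h) g j = coeff-++ʳ h g j

  coeff-last : ∀ h a → coeff (h ++ a ∷ []) (length h) ≡ a
  coeff-last h a = trans (cong (coeff (h ++ a ∷ [])) (sym (ℕ.+-identityʳ (length h)))) (coeff-++ʳ h (a ∷ []) 0)

  lead-last : ∀ h a → lead (h ++ a ∷ []) ≡ a
  lead-last h a rewrite reverse-++ h (a ∷ []) = refl

  Normal : Poly → Set
  Normal f = f ≡ [] ⊎ Σ[ h ∈ Poly ] Σ[ a ∈ ℤ ] f ≡ h ++ a ∷ [] × ¬ a ≡ + 0

  ++-zero : ∀ f → (f ++ + 0 ∷ []) ≋ f
  ++-zero []      = coeffwise λ { zero → refl ; (suc k) → refl }
  ++-zero (a ∷ f) = ∷-cong refl (++-zero f)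

  norm-reverse-zero : ∀ r → norm (reverse (+ 0 ∷ r)) ≡ norm (reverse r)
  norm-reverse-zero r rewrite reverse-involutive (+ 0 ∷ r) | reverse-involutive r = refl

  norm-reverse-nonzero : ∀ a r → ¬ a ≡ + 0 → norm (reverse (a ∷ r)) ≡ reverse (a ∷ r)
  norm-reverse-nonzero (+ 0)      r a≢0 = ⊥-elim (a≢0 refl)
  norm-reverse-nonzero (+ suc n)  r _   rewrite reverse-involutive (+ suc n ∷ r) = refl
  norm-reverse-nonzero -[1+ n ]   r _   rewrite reverse-involutive (-[1+ n ] ∷ r) = refl

  norm-reverse : ∀ r → norm (reverse r) ≋ reverse r × Normal (norm (reverse r))
  norm-reverse [] = ≋-refl , inj₁ refl
  norm-reverse (a ∷ r) with a ℤ.≟ + 0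
  ... | yes refl rewrite norm-reverse-zero r =
    let norm≋ , normal = norm-reverse r in
    ≋-trans norm≋ (≋-trans (≋-sym (++-zero (reverse r))) (≡⇒≋ (sym (unfold-reverse (+ 0) r)))) , normal
  ... | no a≢0 rewrite norm-reverse-nonzero a r a≢0 =
    ≋-refl , inj₂ (reverse r , a , unfold-reverse a r , a≢0)

  norm-≋ : ∀ f → norm f ≋ f
  norm-≋ f = subst (λ g → norm g ≋ g) (reverse-involutive f) (proj₁ (norm-reverse (reverse f)))

  normal-norm : ∀ f → Normal (norm f)
  normal-norm f = subst (λ g → Normal (norm g)) (reverse-involutive f) (proj₂ (norm-reverse (reverse f)))

  length-normal : ∀ {L f} → Normal f → ZeroFrom L f → length f ≤ L
  length-normal (inj₁ refl) z = z≤n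
  length-normal {L} (inj₂ (h , a , refl , a≢0)) z with length h ℕ.<? L
  ... | yes h<L = subst (_≤ L) (sym (length-∷ʳ h a)) h<L
  ... | no  h≮L = ⊥-elim (a≢0 (trans (sym (coeff-last h a)) (z (length h) (ℕ.≮⇒≥ h≮L))))

  length-norm : ∀ {L} f → ZeroFrom L f → length (norm f) ≤ L
  length-norm f z = length-normal (normal-norm f) (zeroFrom-resp-≋ (≋-sym (norm-≋ f)) z)

  norm≡⇒≋ : ∀ G {f} → norm G ≡ f → f ≋ G
  norm≡⇒≋ G refl = norm-≋ G

  +0≢+1 : ¬ (+ 0 ≡ + 1)
  +0≢+1 ()

  monic-norm : ∀ {d} G → Monic d G → Σ[ g′ ∈ Poly ] norm G ≡ g′ ++ + 1 ∷ []
  monic-norm {d} G (lead≡1 , z) with normal-norm G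
  ... | inj₁ norm≡[] = ⊥-elim (+0≢+1 (trans (at (norm≡⇒≋ G norm≡[]) d) lead≡1))
  ... | inj₂ (h , a , norm≡ , a≢0) = h , trans norm≡ (cong (λ c → h ++ c ∷ []) a≡1)
    where
    h≤d : length h ≤ d
    h≤d = ℕ.≤-pred (subst (_≤ suc d) (length-∷ʳ h a)
            (length-normal (inj₂ (h , a , refl , a≢0)) (zeroFrom-resp-≋ (≋-sym (norm≡⇒≋ G norm≡)) z)))
    d≤h : d ≤ length h
    d≤h = ℕ.≮⇒≥ λ h<d → +0≢+1 (trans (sym (zeroFrom-length (h ++ a ∷ []) d (subst (_≤ d) (sym (length-∷ʳ h a)) h<d)))
                                  (trans (at (norm≡⇒≋ G norm≡) d) lead≡1))
    a≡1 : a ≡ + 1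
    a≡1 = trans (sym (coeff-last h a)) (trans (at (norm≡⇒≋ G norm≡) (length h)) (trans (cong (coeff G) (ℕ.≤-antisym h≤d d≤h)) lead≡1))

  coeff-X^⊗ : ∀ s g j → coeff (X^ s ⊗ g) (s ℕ.+ j) ≡ coeff g j
  coeff-X^⊗ zero    g j = at (⊗-identityˡ g) j
  coeff-X^⊗ (suc s) g j = trans (at (shift-⊗ˡ (X^ s) g) (suc (s ℕ.+ j))) (coeff-X^⊗ s g j)

  coeff-const : ∀ a j → coeff (a ∷ []) j ≡ a * coeff (+ 1 ∷ []) j
  coeff-const a zero    = sym (ℤ.*-identityʳ a)
  coeff-const a (suc j) = sym (ℤ.*-zeroʳ a)

  coeff-⊗-last : ∀ h b g c → coeff ((h ++ b ∷ []) ⊗ (g ++ c ∷ [])) (length h ℕ.+ length g) ≡ b * c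
  coeff-⊗-last [] b g c = begin
    coeff ((b ∷ []) ⊗ (g ++ c ∷ [])) (length g)  ≡⟨ coeff-∷⊗ b [] (g ++ c ∷ []) (length g) ⟩
    b * coeff (g ++ c ∷ []) (length g) + coeff (shift ([] ⊗ (g ++ c ∷ []))) (length g)
                                                 ≡⟨ cong₂ _+_ (cong (b *_) (coeff-last g c)) (at shift-[] (length g)) ⟩
    b * c + + 0                                  ≡⟨ ℤ.+-identityʳ _ ⟩
    b * c                                        ∎
    where open ≡-Reasoning
  coeff-⊗-last (x ∷ h) b g c = begin
    coeff ((x ∷ h ++ b ∷ []) ⊗ G) (suc (length h ℕ.+ length g))
      ≡⟨ coeff-∷⊗ x (h ++ b ∷ []) G _ ⟩
    x * coeff G (suc (length h ℕ.+ length g)) + coeff ((h ++ b ∷ []) ⊗ G) (length h ℕ.+ length g)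
      ≡⟨ cong₂ _+_ (cong (x *_) (zeroFrom-length G _ G≤)) (coeff-⊗-last h b g c) ⟩
    x * + 0 + b * c
      ≡⟨ cong (_+ b * c) (ℤ.*-zeroʳ x) ⟩
    + 0 + b * c
      ≡⟨ ℤ.+-identityˡ (b * c) ⟩
    b * c ∎
    where
    open ≡-Reasoning
    G = g ++ c ∷ []
    G≤ : length G ≤ suc (length h ℕ.+ length g)
    G≤ = subst (_≤ _) (sym (length-∷ʳ g c)) (s≤s (ℕ.m≤n+m (length g) (length h)))

  module _ (g′ : Poly) where

    private
      g : Poly
      g = g′ ++ + 1 ∷ []
      d : ℕ
      d = length g′

    zeroFrom-⊗-monic : ∀ q → ZeroFrom d (q ⊗ g) → q ≋ []
    zeroFrom-⊗-monic q z with normal-norm q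
    ... | inj₁ norm≡[] = ≋-sym (norm≡⇒≋ q norm≡[])
    ... | inj₂ (h , b , norm≡ , b≢0) = ⊥-elim (b≢0 (begin
      b                                  ≡⟨ ℤ.*-identityʳ b ⟨
      b * + 1                            ≡⟨ coeff-⊗-last h b g′ (+ 1) ⟨
      coeff ((h ++ b ∷ []) ⊗ g) (length h ℕ.+ d)
                                         ≡⟨ at (⊗-congˡ g (norm≡⇒≋ q norm≡)) _ ⟩
      coeff (q ⊗ g) (length h ℕ.+ d)     ≡⟨ z _ (ℕ.m≤n+m d (length h)) ⟩
      + 0                                ∎))
      where open ≡-Reasoning

    zeroFrom-reduce : ∀ h a → d ≤ length h →
      ZeroFrom (length h) ((h ++ a ∷ []) ⊖ scale a (X^ (length h ∸ d)) ⊗ g)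
    zeroFrom-reduce h a d≤h k h≤k = begin
      coeff (F ⊖ t ⊗ g) k             ≡⟨ coeff-⊕ F (negP (t ⊗ g)) k ⟩
      coeff F k + coeff (negP (t ⊗ g)) k
                                      ≡⟨ cong (_+_ (coeff F k)) (trans (coeff-negP (t ⊗ g) k) (cong -_ t⊗g≡F)) ⟩
      coeff F k + - coeff F k         ≡⟨ ℤ.+-inverseʳ (coeff F k) ⟩
      + 0                             ∎
      where
      open ≡-Reasoning
      F = h ++ a ∷ []
      s = length h ∸ d
      t = scale a (X^ s)
      j = k ∸ length h
      k≡ : k ≡ s ℕ.+ (d ℕ.+ j)
      k≡ = trans (sym (ℕ.m+[n∸m]≡n h≤k))
                 (trans (cong (ℕ._+ j) (sym (ℕ.m∸n+n≡m d≤h))) (ℕ.+-assoc s d j))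
      t⊗g≡F : coeff (t ⊗ g) k ≡ coeff F k
      t⊗g≡F = begin
        coeff (t ⊗ g) k                  ≡⟨ at (scale-⊗ˡ a (X^ s) g) k ⟩
        coeff (scale a (X^ s ⊗ g)) k     ≡⟨ coeff-scale a (X^ s ⊗ g) k ⟩
        a * coeff (X^ s ⊗ g) k           ≡⟨ cong (λ i → a * coeff (X^ s ⊗ g) i) k≡ ⟩
        a * coeff (X^ s ⊗ g) (s ℕ.+ (d ℕ.+ j))
                                         ≡⟨ cong (a *_) (trans (coeff-X^⊗ s g (d ℕ.+ j)) (coeff-++ʳ g′ _ j)) ⟩
        a * coeff (+ 1 ∷ []) j           ≡⟨ coeff-const a j ⟨
        coeff (a ∷ []) j                 ≡⟨ coeff-++ʳ h _ j ⟨
        coeff F (length h ℕ.+ j)         ≡⟨ cong (coeff F) (ℕ.m+[n∸m]≡n h≤k) ⟩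
        coeff F k                        ∎

    private
      QuotFCorrect : ℕ → Set
      QuotFCorrect n = ∀ f q → length (norm f) < n → f ≋ q ⊗ g → quotF n f g ≋ q

      division-step : ∀ n F q → Normal F → F ≋ q ⊗ g → ¬ length F < length g → length F < suc n →
        QuotFCorrect n →
        (scale (lead F) (X^ (length F ∸ length g)) ⊕
           quotF n (F ⊖ scale (lead F) (X^ (length F ∸ length g)) ⊗ g) g) ≋ q
      division-step n .[] q (inj₁ refl) _ F≮g _ _ =
        ⊥-elim (F≮g (subst (0 <_) (sym (length-∷ʳ g′ (+ 1))) (s≤s z≤n)))
      division-step n .(h ++ a ∷ []) q (inj₂ (h , a , refl , _)) F≋ F≮g F<1+n IH
        rewrite lead-last h a | length-∷ʳ g′ (+ 1) | length-∷ʳ h a =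
        ≋-trans (⊕-cong ≋-refl (IH _ (q ⊖ t) rem< rem≋)) (add-sub t q)
        where
        t = scale a (X^ (length h ∸ d))
        d≤h : d ≤ length h
        d≤h = ℕ.≮⇒≥ λ h<d → F≮g (s≤s h<d)
        add-sub : ∀ t q → (t ⊕ (q ⊖ t)) ≋ q
        add-sub = solve-∀ ℤ[x]-solver
        sub-distrib : ∀ q t g → (q ⊗ g ⊖ t ⊗ g) ≋ ((q ⊖ t) ⊗ g)
        sub-distrib = solve-∀ ℤ[x]-solver
        rem≋ : ((h ++ a ∷ []) ⊖ t ⊗ g) ≋ ((q ⊖ t) ⊗ g)
        rem≋ = ≋-trans (⊕-cong F≋ ≋-refl) (sub-distrib q t g)
        rem< : length (norm ((h ++ a ∷ []) ⊖ t ⊗ g)) < n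
        rem< = ℕ.≤-<-trans (length-norm ((h ++ a ∷ []) ⊖ t ⊗ g) (zeroFrom-reduce h a d≤h)) (ℕ.≤-pred F<1+n)

    quotF-correct : ∀ n → QuotFCorrect n
    quotF-correct zero    f q () _
    quotF-correct (suc n) f q f<1+n f≋ with length (norm f) ℕ.<ᵇ length g in short
    ... | true  = ≋-sym (zeroFrom-⊗-monic q (zeroFrom-resp-≋ (≋-trans (norm-≋ f) f≋)
                    (zeroFrom-mono (norm f) norm≤d (zeroFrom-length (norm f)))))
      where
      norm≤d : length (norm f) ≤ d
      norm≤d = ℕ.≤-pred (subst (suc (length (norm f)) ≤_) (length-∷ʳ g′ (+ 1))
                 (ℕ.<ᵇ⇒< _ _ (subst T (sym short) _)))
    ... | false = division-step n (norm f) q (normal-norm f) (≋-trans (norm-≋ f) f≋)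
                    (λ f<g → subst T short (ℕ.<⇒<ᵇ f<g)) f<1+n (quotF-correct n)

  quotMonic-correct : ∀ {d f q} G → Monic d G → f ≋ q ⊗ G → quotMonic f G ≋ q
  quotMonic-correct {f = f} {q} G monic f≋ with monic-norm G monic
  ... | g′ , norm≡ = subst (λ g → quotF (suc (length f)) f g ≋ q) (sym norm≡)
        (quotF-correct g′ (suc (length f)) f q (s≤s (length-norm f (zeroFrom-length f)))
          (≋-trans f≋ (⊗-congʳ q (≋-sym (norm≡⇒≋ G norm≡)))))

open MonicDivision

module CyclotomicTable where

  open import Data.Nat using (ℕ; zero; suc; _*_; _≤_; _<_; _∸_; s≤s; z≤n)
  import Data.Nat.Properties as ℕ
  open import Data.Nat.Divisibility using (_∣_; _∣?_; divides; *-cancelʳ-∣; n∣m*n; m∣m*n; 1∣_)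
  open import Data.Nat.Primality using (Prime; prime?; prime⇒irreducible; prime⇒nonZero; ¬prime[1])
  open import Data.Nat.Coprimality using (Coprime; coprime-divisor)
  open import Data.List using (foldr; map; upTo; filterᵇ)
  open import Data.List.Properties using (length-++; map-++; upTo-∷ʳ; filter-++; ++-identityʳ)
  open import Relation.Nullary using (does)
  open import Relation.Nullary.Decidable using (T?; dec-true; dec-false; from-yes)

  length-table : ∀ n → length (table n) ≡ n
  length-table zero    = refl
  length-table (suc n) = trans (length-++ (table n)) (trans (ℕ.+-comm (length (table n)) 1) (cong suc (length-table n)))

  nth-++ˡ : ∀ l m k → k < length l → nth (l ++ m) k ≡ nth l k
  nth-++ˡ (x ∷ l) m zero    _         = refl
  nth-++ˡ (x ∷ l) m (suc k) (s≤s k<l) = nth-++ˡ l m k k<l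

  nth-last : ∀ l x → nth (l ++ x ∷ []) (length l) ≡ x
  nth-last []      x = refl
  nth-last (y ∷ l) x = nth-last l x

  nth-table : ∀ d m → suc d ≤ m → nth (table m) d ≡ Φ (suc d)
  nth-table d (suc m) (s≤s d≤m) with d ℕ.≟ m
  ... | yes refl = refl
  ... | no  d≢m  = trans (nth-++ˡ (table m) _ d (subst (d <_) (sym (length-table m)) d<m)) (nth-table d m d<m)
    where d<m = ℕ.≤∧≢⇒< d≤m d≢m

  divisorsUpTo : ℕ → ℕ → List ℕ
  divisorsUpTo m n = filterᵇ (λ d → does (d ∣? m)) (map suc (upTo n))

  productOfTable : ℕ → List ℕ → Poly
  productOfTable n ds = foldr (λ d acc → nth (table n) (d ∸ 1) ⊗ acc) oneP ds

  Φ-suc : ∀ n → Φ (suc n) ≡ quotMonic (X^ (suc n) ⊖ oneP) (productOfTable n (divisorsUpTo (suc n) n))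
  Φ-suc n = subst (λ k → nth (table n ++ Φₙ₊₁ ∷ []) k ≡ Φₙ₊₁) (length-table n) (nth-last (table n) Φₙ₊₁)
    where Φₙ₊₁ = quotMonic (X^ (suc n) ⊖ oneP) (productOfTable n (divisorsUpTo (suc n) n))

  divisorsUpTo-suc : ∀ m n → divisorsUpTo m (suc n) ≡ divisorsUpTo m n ++ filterᵇ (λ d → does (d ∣? m)) (suc n ∷ [])
  divisorsUpTo-suc m n =
    trans (cong (filterᵇ (λ d → does (d ∣? m))) (trans (cong (map suc) (sym (upTo-∷ʳ n))) (map-++ suc (upTo n) (n ∷ []))))
          (filter-++ (λ d → T? (does (d ∣? m))) (map suc (upTo n)) (suc n ∷ []))

  divisorsUpTo-∣ : ∀ m n → suc n ∣ m → divisorsUpTo m (suc n) ≡ divisorsUpTo m n ++ suc n ∷ []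
  divisorsUpTo-∣ m n ∣m rewrite divisorsUpTo-suc m n | dec-true (suc n ∣? m) ∣m = refl

  divisorsUpTo-∤ : ∀ m n → ¬ suc n ∣ m → divisorsUpTo m (suc n) ≡ divisorsUpTo m n
  divisorsUpTo-∤ m n ∤m rewrite divisorsUpTo-suc m n | dec-false (suc n ∣? m) ∤m = ++-identityʳ _

  divisorsUpTo-gap : ∀ m a b → a ≤ b → (∀ d → a < d → d ≤ b → ¬ d ∣ m) → divisorsUpTo m b ≡ divisorsUpTo m a
  divisorsUpTo-gap m a zero    z≤n   _   = refl
  divisorsUpTo-gap m a (suc b) a≤1+b gap with ℕ.m≤n⇒m<n∨m≡n a≤1+b
  ... | inj₂ refl      = refl
  ... | inj₁ (s≤s a≤b) = trans (divisorsUpTo-∤ m b (gap (suc b) (s≤s a≤b) ℕ.≤-refl))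
                               (divisorsUpTo-gap m a b a≤b λ d a<d d≤b → gap d a<d (ℕ.m≤n⇒m≤1+n d≤b))

  divisor-of-prime-product : ∀ {q p d} → Prime q → Prime p → d ∣ q * p → d ≡ 1 ⊎ d ≡ q ⊎ d ≡ p ⊎ d ≡ q * p
  divisor-of-prime-product {q} {p} {d} q-prime p-prime d∣qp with p ∣? d
  ... | yes (divides k refl) with prime⇒irreducible q-prime (*-cancelʳ-∣ {k} {q} p ⦃ prime⇒nonZero p-prime ⦄ d∣qp)
  ...   | inj₁ refl = inj₂ (inj₂ (inj₁ (ℕ.*-identityˡ p)))
  ...   | inj₂ refl = inj₂ (inj₂ (inj₂ refl))
  divisor-of-prime-product {q} {p} {d} q-prime p-prime d∣qp | no p∤d
    with prime⇒irreducible q-prime (coprime-divisor d⊥p (subst (d ∣_) (ℕ.*-comm q p) d∣qp))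
    where
    d⊥p : Coprime d p
    d⊥p (e∣d , e∣p) with prime⇒irreducible p-prime e∣p
    ... | inj₁ e≡1 = e≡1
    ... | inj₂ refl = ⊥-elim (p∤d e∣d)
  ... | inj₁ d≡1 = inj₁ d≡1
  ... | inj₂ d≡q = inj₂ (inj₁ d≡q)

  no-divisor-between : ∀ m a b → (∀ v → v ∣ m → v ≤ a ⊎ b < v) → ∀ d → a < d → d ≤ b → ¬ d ∣ m
  no-divisor-between m a b outside d a<d d≤b d∣m with outside d d∣m
  ... | inj₁ d≤a = ℕ.<⇒≱ a<d d≤a
  ... | inj₂ b<d = ℕ.<⇒≱ b<d d≤b

  divisorsUpTo-prime : ∀ n → Prime (suc n) → divisorsUpTo (suc n) n ≡ 1 ∷ []
  divisorsUpTo-prime zero    p-prime = ⊥-elim (¬prime[1] p-prime)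
  divisorsUpTo-prime (suc n) p-prime =
    trans (divisorsUpTo-gap p 1 (suc n) (s≤s z≤n) (no-divisor-between p 1 (suc n) outside))
          (divisorsUpTo-∣ p 0 (1∣ p))
    where
    p = suc (suc n)
    outside : ∀ v → v ∣ p → v ≤ 1 ⊎ suc n < v
    outside v v∣p with prime⇒irreducible p-prime v∣p
    ... | inj₁ refl = inj₁ ℕ.≤-refl
    ... | inj₂ refl = inj₂ ℕ.≤-refl

  divisorsUpTo-3p : ∀ p′ → Prime (suc p′) → 3 < suc p′ →
                    divisorsUpTo (3 * suc p′) (3 * suc p′ ∸ 1) ≡ 1 ∷ 3 ∷ suc p′ ∷ []
  divisorsUpTo-3p p′ p-prime 3<p = begin
    divisorsUpTo m (m ∸ 1)
      ≡⟨ divisorsUpTo-gap m p (m ∸ 1) p≤m-1 (no-divisor-between m p (m ∸ 1) above-p) ⟩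
    divisorsUpTo m p
      ≡⟨ divisorsUpTo-∣ m p′ (n∣m*n 3) ⟩
    divisorsUpTo m p′ ++ p ∷ []
      ≡⟨ cong (_++ p ∷ []) (divisorsUpTo-gap m 3 p′ (ℕ.≤-pred 3<p) (no-divisor-between m 3 p′ between-3-p)) ⟩
    divisorsUpTo m 3 ++ p ∷ []
      ≡⟨ cong (_++ p ∷ []) (divisorsUpTo-∣ m 2 (m∣m*n p)) ⟩
    (divisorsUpTo m 2 ++ 3 ∷ []) ++ p ∷ []
      ≡⟨ cong (λ l → (l ++ 3 ∷ []) ++ p ∷ []) (divisorsUpTo-∤ m 1 (no-divisor-between m 1 2 between-1-3 2 ℕ.≤-refl ℕ.≤-refl)) ⟩
    (divisorsUpTo m 1 ++ 3 ∷ []) ++ p ∷ []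
      ≡⟨ cong (λ l → (l ++ 3 ∷ []) ++ p ∷ []) (divisorsUpTo-∣ m 0 (1∣ m)) ⟩
    1 ∷ 3 ∷ p ∷ []
      ∎
    where
    open ≡-Reasoning
    p = suc p′
    m = 3 * p
    3-prime : Prime 3
    3-prime = from-yes (prime? 3)
    p<m : p < m
    p<m = ℕ.m<m+n p (s≤s z≤n)
    p≤m-1 : p ≤ m ∸ 1
    p≤m-1 = ℕ.≤-pred p<m
    classify : ∀ v → v ∣ m → v ≡ 1 ⊎ v ≡ 3 ⊎ v ≡ p ⊎ v ≡ m
    classify v = divisor-of-prime-product 3-prime p-prime
    above-p : ∀ v → v ∣ m → v ≤ p ⊎ m ∸ 1 < v
    above-p v v∣m with classify v v∣m
    ... | inj₁ refl               = inj₁ (s≤s z≤n)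
    ... | inj₂ (inj₁ refl)        = inj₁ (ℕ.<⇒≤ 3<p)
    ... | inj₂ (inj₂ (inj₁ refl)) = inj₁ ℕ.≤-refl
    ... | inj₂ (inj₂ (inj₂ refl)) = inj₂ (ℕ.n<1+n (m ∸ 1))
    between-3-p : ∀ v → v ∣ m → v ≤ 3 ⊎ p′ < v
    between-3-p v v∣m with classify v v∣m
    ... | inj₁ refl               = inj₁ (s≤s z≤n)
    ... | inj₂ (inj₁ refl)        = inj₁ ℕ.≤-refl
    ... | inj₂ (inj₂ (inj₁ refl)) = inj₂ ℕ.≤-refl
    ... | inj₂ (inj₂ (inj₂ refl)) = inj₂ (ℕ.<-trans ℕ.≤-refl p<m)
    between-1-3 : ∀ v → v ∣ m → v ≤ 1 ⊎ 2 < v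
    between-1-3 v v∣m with classify v v∣m
    ... | inj₁ refl               = inj₁ ℕ.≤-refl
    ... | inj₂ (inj₁ refl)        = inj₂ ℕ.≤-refl
    ... | inj₂ (inj₂ (inj₁ refl)) = inj₂ (ℕ.<-trans (s≤s (s≤s (s≤s z≤n))) 3<p)
    ... | inj₂ (inj₂ (inj₂ refl)) = inj₂ (ℕ.<-trans (s≤s (s≤s (s≤s z≤n))) (ℕ.<-trans 3<p p<m))

open CyclotomicTable

module ClosedForms where

  open import Data.Nat as ℕ using (ℕ; zero; suc; _≤_; _<_; _∸_; s≤s; z≤n)
  import Data.Nat.Properties as ℕ
  open import Data.Integer using (+_; -[1+_])
  open import Data.Nat.DivMod using (_%_; _/_; m≡m%n+[m/n]*n; m%n<n)
  open import Data.Nat.Divisibility using (_∣_; divides)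
  open import Data.Nat.Primality using (Prime)
  import Data.Nat.Tactic.RingSolver as ℕ-Solver
  open import Tactic.RingSolver using (solve-∀)
  open import Relation.Binary.Reasoning.Setoid ≋-setoid

  Φ₁ Φ₃ : Poly
  Φ₁ = -[1+ 0 ] ∷ + 1 ∷ []
  Φ₃ = + 1 ∷ + 1 ∷ + 1 ∷ []

  ones : ℕ → Poly
  ones n = replicate n (+ 1)

  Φ₃[X^_] : ℕ → Poly
  Φ₃[X^ p ] = oneP ⊕ X^ p ⊕ X^ (p ℕ.+ p)

  X^-+ : ∀ a b → (X^ a ⊗ X^ b) ≋ X^ (a ℕ.+ b)
  X^-+ zero    b = ⊗-identityˡ (X^ b)
  X^-+ (suc a) b = ≋-trans (shift-⊗ˡ (X^ a) (X^ b)) (shift-cong (X^-+ a b))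

  X^-+-≡ : ∀ a b {c} → a ℕ.+ b ≡ c → (X^ a ⊗ X^ b) ≋ X^ c
  X^-+-≡ a b refl = X^-+ a b

  shift-≋-X⊗ : ∀ f → shift f ≋ (X^ 1 ⊗ f)
  shift-≋-X⊗ f = ≋-sym (≋-trans (shift-⊗ˡ oneP f) (shift-cong (⊗-identityˡ f)))

  ones-⊗-Φ₁ : ∀ n → (ones n ⊗ Φ₁) ≋ (X^ n ⊖ oneP)
  ones-⊗-Φ₁ zero    = coeffwise λ { zero → refl ; (suc k) → refl }
  ones-⊗-Φ₁ (suc n) = begin
    ones (suc n) ⊗ Φ₁                   ≈⟨ ⊕-cong (scale-one Φ₁) (shift-cong (ones-⊗-Φ₁ n)) ⟩
    Φ₁ ⊕ shift (X^ n ⊖ oneP)            ≈⟨ ⊕-cong Φ₁≋ (shift-≋-X⊗ (X^ n ⊖ oneP)) ⟩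
    (X^ 1 ⊖ oneP) ⊕ X^ 1 ⊗ (X^ n ⊖ oneP) ≈⟨ telescope (X^ 1) (X^ n) ⟩
    X^ 1 ⊗ X^ n ⊖ oneP                  ≈⟨ ⊕-cong (X^-+ 1 n) ≋-refl ⟩
    X^ (suc n) ⊖ oneP                   ∎
    where
    Φ₁≋ : Φ₁ ≋ (X^ 1 ⊖ oneP)
    Φ₁≋ = coeffwise λ { 0 → refl ; 1 → refl ; (suc (suc k)) → refl }
    telescope : ∀ x y → ((x ⊖ oneP) ⊕ x ⊗ (y ⊖ oneP)) ≋ (x ⊗ y ⊖ oneP)
    telescope = solve-∀ ℤ[x]-solver

  powers³ : ℕ → Poly
  powers³ N = sumTo N (λ j → X^ (3 ℕ.* j))

  powers³-telescope : ∀ N → ((oneP ⊖ X^ 3) ⊗ powers³ N) ≋ (oneP ⊖ X^ (3 ℕ.* suc N))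
  powers³-telescope zero    = ⊗-identityʳ (oneP ⊖ X^ 3)
  powers³-telescope (suc N) = begin
    (oneP ⊖ X^ 3) ⊗ (powers³ N ⊕ X^ (3 ℕ.* suc N))
      ≈⟨ ⊗-distribˡ (oneP ⊖ X^ 3) (powers³ N) _ ⟩
    (oneP ⊖ X^ 3) ⊗ powers³ N ⊕ (oneP ⊖ X^ 3) ⊗ X^ (3 ℕ.* suc N)
      ≈⟨ ⊕-cong (powers³-telescope N) ≋-refl ⟩
    (oneP ⊖ X^ (3 ℕ.* suc N)) ⊕ (oneP ⊖ X^ 3) ⊗ X^ (3 ℕ.* suc N)
      ≈⟨ telescope (X^ 3) (X^ (3 ℕ.* suc N)) ⟩
    oneP ⊖ X^ 3 ⊗ X^ (3 ℕ.* suc N)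
      ≈⟨ ⊖-cong (≋-refl {oneP}) (X^-+-≡ 3 (3 ℕ.* suc N) (sym (ℕ.*-suc 3 (suc N)))) ⟩
    oneP ⊖ X^ (3 ℕ.* suc (suc N))  ∎
    where
    telescope : ∀ x y → ((oneP ⊖ y) ⊕ (oneP ⊖ x) ⊗ y) ≋ (oneP ⊖ x ⊗ y)
    telescope = solve-∀ ℤ[x]-solver

  -- 1/Φ₃ = (1 - x)/(1 - x³) modulo x^(3N+3).
  recipΦ₃ : ℕ → Poly
  recipΦ₃ N = (oneP ⊖ X^ 1) ⊗ powers³ N

  zeroBelow-Φ₃-cancel : ∀ m g → ZeroBelow m (Φ₃ ⊗ g) → ZeroBelow m g
  zeroBelow-Φ₃-cancel m = zeroBelow-cancelˡ m (+ 1 ∷ + 1 ∷ [])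

  Φ₃-⊗-recipΦ₃ : ∀ N → (Φ₃ ⊗ recipΦ₃ N) ≋ (oneP ⊖ X^ (3 ℕ.* suc N))
  Φ₃-⊗-recipΦ₃ N = begin
    Φ₃ ⊗ ((oneP ⊖ X^ 1) ⊗ powers³ N)  ≈⟨ ≋-sym (⊗-assoc Φ₃ (oneP ⊖ X^ 1) (powers³ N)) ⟩
    (Φ₃ ⊗ (oneP ⊖ X^ 1)) ⊗ powers³ N  ≈⟨ ⊗-congˡ (powers³ N) Φ₃⊗[1-x] ⟩
    (oneP ⊖ X^ 3) ⊗ powers³ N         ≈⟨ powers³-telescope N ⟩
    oneP ⊖ X^ (3 ℕ.* suc N)           ∎
    where
    Φ₃⊗[1-x] : (Φ₃ ⊗ (oneP ⊖ X^ 1)) ≋ (oneP ⊖ X^ 3)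
    Φ₃⊗[1-x] = coeffwise λ { 0 → refl ; 1 → refl ; 2 → refl ; 3 → refl ; (suc (suc (suc (suc k)))) → refl }

  recipΦ₃-suc : ∀ N → recipΦ₃ (suc N) ≋ (recipΦ₃ N ⊕ X^ (3 ℕ.* suc N) ⊖ X^ (suc (3 ℕ.* suc N)))
  recipΦ₃-suc N = ≋-trans (⊗-distribˡ (oneP ⊖ X^ 1) (powers³ N) (X^ i))
                          (≋-trans (distrib (X^ 1) (powers³ N) (X^ i)) (⊖-cong ≋-refl (X^-+ 1 i)))
    where
    i = 3 ℕ.* suc N
    distrib : ∀ x s y → ((oneP ⊖ x) ⊗ s ⊕ (oneP ⊖ x) ⊗ y) ≋ ((oneP ⊖ x) ⊗ s ⊕ y ⊖ x ⊗ y)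
    distrib = solve-∀ ℤ[x]-solver

  zeroFrom-powers³ : ∀ N → ZeroFrom (suc (3 ℕ.* N)) (powers³ N)
  zeroFrom-powers³ zero    = zeroFrom-X^ 0
  zeroFrom-powers³ (suc N) =
    zeroFrom-⊕ (powers³ N) (X^ (3 ℕ.* suc N))
      (zeroFrom-mono (powers³ N) (s≤s (ℕ.*-monoʳ-≤ 3 (ℕ.n≤1+n N))) (zeroFrom-powers³ N))
      (zeroFrom-X^ (3 ℕ.* suc N))

  zeroFrom-recipΦ₃ : ∀ N → ZeroFrom (suc (suc (3 ℕ.* N))) (recipΦ₃ N)
  zeroFrom-recipΦ₃ N = zeroFrom-resp-≋ (≋-sym recip≋) (zeroFrom-⊕ S (negP (shift S))
      (zeroFrom-mono S (ℕ.n≤1+n _) (zeroFrom-powers³ N))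
      (zeroFrom-negP (shift S) (zeroFrom-shift S (zeroFrom-powers³ N))))
    where
    S = powers³ N
    recip≋ : recipΦ₃ N ≋ (S ⊖ shift S)
    recip≋ = ≋-trans (expand (X^ 1) S) (⊖-cong ≋-refl (≋-sym (shift-≋-X⊗ S)))
      where
      expand : ∀ x s → ((oneP ⊖ x) ⊗ s) ≋ (s ⊖ x ⊗ s)
      expand = solve-∀ ℤ[x]-solver

  Φ₃-⊗-complement : ∀ p a b α β → a ℕ.+ 3 ℕ.* suc α ≡ p → b ℕ.+ 3 ℕ.* suc β ≡ p ℕ.+ p →
    Φ₃ ≋ (oneP ⊕ X^ a ⊕ X^ b) →
    (Φ₃ ⊗ (oneP ⊖ (X^ a ⊗ recipΦ₃ α ⊕ X^ b ⊗ recipΦ₃ β))) ≋ Φ₃[X^ p ]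
  Φ₃-⊗-complement p a b α β a+3α′≡p b+3β′≡2p Φ₃≋ = begin
    Φ₃ ⊗ (oneP ⊖ (X^ a ⊗ recipΦ₃ α ⊕ X^ b ⊗ recipΦ₃ β))
      ≈⟨ expand Φ₃ (X^ a) (recipΦ₃ α) (X^ b) (recipΦ₃ β) ⟩
    Φ₃ ⊖ (X^ a ⊗ (Φ₃ ⊗ recipΦ₃ α) ⊕ X^ b ⊗ (Φ₃ ⊗ recipΦ₃ β))
      ≈⟨ ⊖-cong Φ₃≋ (⊕-cong (⊗-congʳ (X^ a) (Φ₃-⊗-recipΦ₃ α)) (⊗-congʳ (X^ b) (Φ₃-⊗-recipΦ₃ β))) ⟩
    (oneP ⊕ X^ a ⊕ X^ b) ⊖ (X^ a ⊗ (oneP ⊖ X^ (3 ℕ.* suc α)) ⊕ X^ b ⊗ (oneP ⊖ X^ (3 ℕ.* suc β)))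
      ≈⟨ cancel (X^ a) (X^ b) (X^ (3 ℕ.* suc α)) (X^ (3 ℕ.* suc β)) ⟩
    oneP ⊕ X^ a ⊗ X^ (3 ℕ.* suc α) ⊕ X^ b ⊗ X^ (3 ℕ.* suc β)
      ≈⟨ ⊕-cong (⊕-cong (≋-refl {oneP}) (X^-+-≡ a _ a+3α′≡p)) (X^-+-≡ b _ b+3β′≡2p) ⟩
    Φ₃[X^ p ] ∎
    where
    expand : ∀ φ x r y s → (φ ⊗ (oneP ⊖ (x ⊗ r ⊕ y ⊗ s))) ≋ (φ ⊖ (x ⊗ (φ ⊗ r) ⊕ y ⊗ (φ ⊗ s)))
    expand = solve-∀ ℤ[x]-solver
    cancel : ∀ x y u v → ((oneP ⊕ x ⊕ y) ⊖ (x ⊗ (oneP ⊖ u) ⊕ y ⊗ (oneP ⊖ v))) ≋ (oneP ⊕ x ⊗ u ⊕ y ⊗ v)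
    cancel = solve-∀ ℤ[x]-solver

  exponents-mod-1 : ∀ m → let p = 1 ℕ.+ suc m ℕ.* 3 in
    1 ℕ.+ 3 ℕ.* suc m ≡ p × 2 ℕ.+ 3 ℕ.* suc (suc (2 ℕ.* m)) ≡ p ℕ.+ p
  exponents-mod-1 m = ℕ-Solver.solve (m ∷ []) , ℕ-Solver.solve (m ∷ [])

  exponents-mod-2 : ∀ m → let p = 2 ℕ.+ suc m ℕ.* 3 in
    2 ℕ.+ 3 ℕ.* suc m ≡ p × 1 ℕ.+ 3 ℕ.* suc (suc (suc (2 ℕ.* m))) ≡ p ℕ.+ p
  exponents-mod-2 m = ℕ-Solver.solve (m ∷ []) , ℕ-Solver.solve (m ∷ [])

  Φ₃-divides-Φ₃[X^p] : ∀ p → 3 < p → ¬ 3 ∣ p → Σ[ q ∈ Poly ] (Φ₃ ⊗ q) ≋ Φ₃[X^ p ]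
  Φ₃-divides-Φ₃[X^p] p 3<p 3∤p with p % 3 | p / 3 | m≡m%n+[m/n]*n p 3 | m%n<n p 3
  ... | 0 | k     | p≡ | _ = ⊥-elim (3∤p (divides k p≡))
  ... | r | 0     | p≡ | r<3 =
    ⊥-elim (ℕ.<⇒≱ 3<p (subst (_≤ 3) (sym (trans p≡ (ℕ.+-identityʳ r))) (ℕ.<⇒≤ r<3)))
  ... | 1 | suc m | refl | _ = let eα , eβ = exponents-mod-1 m in
    _ , Φ₃-⊗-complement p 1 2 m (suc (2 ℕ.* m)) eα eβ
          (coeffwise λ { 0 → refl ; 1 → refl ; 2 → refl ; (suc (suc (suc k))) → refl })
  ... | 2 | suc m | refl | _ = let eα , eβ = exponents-mod-2 m in
    _ , Φ₃-⊗-complement p 2 1 m (suc (suc (2 ℕ.* m))) eα eβ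
          (coeffwise λ { 0 → refl ; 1 → refl ; 2 → refl ; (suc (suc (suc k))) → refl })
  ... | suc (suc (suc r)) | _ | _ | s≤s (s≤s (s≤s ()))

  monic-Φ₃⊗[X^p-1] : ∀ p → 1 ≤ p → Monic (2 ℕ.+ p) (Φ₃ ⊗ (X^ p ⊖ oneP))
  monic-Φ₃⊗[X^p-1] p 1≤p = monic-resp-≋ (≋-sym Φ₃⊗[X^p-1]≋)
    (monic-X^⊕ (2 ℕ.+ p) lower (zeroFrom-⊕ (X^ (1 ℕ.+ p) ⊕ X^ p) (negP Φ₃)
      (zeroFrom-⊕ (X^ (1 ℕ.+ p)) (X^ p) (zeroFrom-X^ (1 ℕ.+ p)) (zeroFrom-mono (X^ p) (ℕ.n≤1+n _) (zeroFrom-X^ p)))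
      (zeroFrom-negP Φ₃ (zeroFrom-mono Φ₃ (s≤s (s≤s 1≤p)) (zeroFrom-length Φ₃)))))
    where
    lower = X^ (1 ℕ.+ p) ⊕ X^ p ⊖ Φ₃
    Φ₃≋ : Φ₃ ≋ (oneP ⊕ X^ 1 ⊕ X^ 1 ⊗ X^ 1)
    Φ₃≋ = coeffwise λ { 0 → refl ; 1 → refl ; 2 → refl ; (suc (suc (suc k))) → refl }
    expand : ∀ x y → ((oneP ⊕ x ⊕ x ⊗ x) ⊗ (y ⊖ oneP)) ≋ (x ⊗ (x ⊗ y) ⊕ (x ⊗ y ⊕ y ⊖ (oneP ⊕ x ⊕ x ⊗ x)))
    expand = solve-∀ ℤ[x]-solver
    Φ₃⊗[X^p-1]≋ : (Φ₃ ⊗ (X^ p ⊖ oneP)) ≋ (X^ (2 ℕ.+ p) ⊕ lower)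
    Φ₃⊗[X^p-1]≋ = begin
      Φ₃ ⊗ (X^ p ⊖ oneP)
        ≈⟨ ⊗-congˡ (X^ p ⊖ oneP) Φ₃≋ ⟩
      (oneP ⊕ X^ 1 ⊕ X^ 1 ⊗ X^ 1) ⊗ (X^ p ⊖ oneP)
        ≈⟨ expand (X^ 1) (X^ p) ⟩
      X^ 1 ⊗ (X^ 1 ⊗ X^ p) ⊕ (X^ 1 ⊗ X^ p ⊕ X^ p ⊖ (oneP ⊕ X^ 1 ⊕ X^ 1 ⊗ X^ 1))
        ≈⟨ ⊕-cong (≋-trans (⊗-congʳ (X^ 1) (X^-+ 1 p)) (X^-+ 1 (1 ℕ.+ p)))
                  (⊖-cong (⊕-cong (X^-+ 1 p) (≋-refl {X^ p})) (≋-sym Φ₃≋)) ⟩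
      X^ (2 ℕ.+ p) ⊕ lower  ∎

  Φ₃[X^p]-⊗-[X^p-1] : ∀ p → (Φ₃[X^ p ] ⊗ (X^ p ⊖ oneP)) ≋ (X^ (3 ℕ.* p) ⊖ oneP)
  Φ₃[X^p]-⊗-[X^p-1] p = begin
    (oneP ⊕ X^ p ⊕ X^ (p ℕ.+ p)) ⊗ (X^ p ⊖ oneP)
      ≈⟨ expand (X^ p) (X^ (p ℕ.+ p)) ⟩
    X^ (p ℕ.+ p) ⊗ X^ p ⊖ oneP ⊕ (X^ p ⊗ X^ p ⊖ X^ (p ℕ.+ p))
      ≈⟨ ⊕-cong (⊕-cong (X^-+-≡ (p ℕ.+ p) p p+p+p≡3p) ≋-refl)
                (≋-trans (⊕-cong (X^-+ p p) ≋-refl) (⊕-inverseʳ (X^ (p ℕ.+ p)))) ⟩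
    X^ (3 ℕ.* p) ⊖ oneP ⊕ []
      ≈⟨ ⊕-identityʳ _ ⟩
    X^ (3 ℕ.* p) ⊖ oneP  ∎
    where
    expand : ∀ y z → ((oneP ⊕ y ⊕ z) ⊗ (y ⊖ oneP)) ≋ (z ⊗ y ⊖ oneP ⊕ (y ⊗ y ⊖ z))
    expand = solve-∀ ℤ[x]-solver
    p+p+p≡3p : p ℕ.+ p ℕ.+ p ≡ 3 ℕ.* p
    p+p+p≡3p = ℕ-Solver.solve (p ∷ [])

  Φ-prime : ∀ n → Prime (suc n) → 1 ≤ n → Φ (suc n) ≋ ones (suc n)
  Φ-prime n p-prime 1≤n rewrite Φ-suc n | divisorsUpTo-prime n p-prime | nth-table 0 n 1≤n =
    quotMonic-correct (Φ₁ ⊗ oneP) monic-Φ₁⊗1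
      (≋-sym (≋-trans (⊗-congʳ (ones (suc n)) (⊗-identityʳ Φ₁)) (ones-⊗-Φ₁ (suc n))))
    where
    monic-Φ₁⊗1 : Monic 1 (Φ₁ ⊗ oneP)
    monic-Φ₁⊗1 = refl , λ { (suc (suc k)) _ → refl ; 0 () ; 1 (s≤s ()) }

  Φ-3p : ∀ p q → Prime p → 3 < p → (Φ₃ ⊗ q) ≋ Φ₃[X^ p ] → Φ (3 ℕ.* p) ≋ q
  Φ-3p (suc p′) q p-prime 3<p Φ₃⊗q≋ = subst (_≋ q) (sym Φ3p≡) (quotMonic-correct G monic-G quotient)
    where
    p = suc p′
    n = 3 ℕ.* p ∸ 1
    G = Φ₁ ⊗ (Φ₃ ⊗ (Φ p ⊗ oneP))
    p≤n : p ≤ n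
    p≤n = ℕ.≤-pred (ℕ.m<m+n p (s≤s z≤n))
    3≤n : 3 ≤ n
    3≤n = ℕ.≤-trans (ℕ.<⇒≤ 3<p) p≤n
    product≡G : productOfTable n (1 ∷ 3 ∷ p ∷ []) ≡ G
    product≡G rewrite nth-table 0 n (ℕ.≤-trans (s≤s z≤n) 3≤n) | nth-table 2 n 3≤n | nth-table p′ n p≤n = refl
    Φ3p≡ : Φ (3 ℕ.* p) ≡ quotMonic (X^ (3 ℕ.* p) ⊖ oneP) G
    Φ3p≡ = trans (Φ-suc n) (cong (quotMonic (X^ (3 ℕ.* p) ⊖ oneP))
             (trans (cong (productOfTable n) (divisorsUpTo-3p p′ p-prime 3<p)) product≡G))
    G≋ : G ≋ (Φ₃ ⊗ (X^ p ⊖ oneP))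
    G≋ = begin
      Φ₁ ⊗ (Φ₃ ⊗ (Φ p ⊗ oneP))     ≈⟨ ⊗-congʳ Φ₁ (⊗-congʳ Φ₃ (⊗-congˡ oneP (Φ-prime p′ p-prime 1≤p′))) ⟩
      Φ₁ ⊗ (Φ₃ ⊗ (ones p ⊗ oneP))  ≈⟨ rearrange Φ₁ Φ₃ (ones p) ⟩
      Φ₃ ⊗ (ones p ⊗ Φ₁)           ≈⟨ ⊗-congʳ Φ₃ (ones-⊗-Φ₁ p) ⟩
      Φ₃ ⊗ (X^ p ⊖ oneP)           ∎
      where
      1≤p′ : 1 ≤ p′
      1≤p′ = ℕ.≤-pred (ℕ.<-trans (s≤s (s≤s z≤n)) 3<p)
      rearrange : ∀ a b c → (a ⊗ (b ⊗ (c ⊗ oneP))) ≋ (b ⊗ (c ⊗ a))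
      rearrange = solve-∀ ℤ[x]-solver
    monic-G : Monic (2 ℕ.+ p) G
    monic-G = monic-resp-≋ (≋-sym G≋) (monic-Φ₃⊗[X^p-1] p (s≤s z≤n))
    quotient : (X^ (3 ℕ.* p) ⊖ oneP) ≋ (q ⊗ G)
    quotient = ≋-sym (begin
      q ⊗ G                         ≈⟨ ⊗-congʳ q G≋ ⟩
      q ⊗ (Φ₃ ⊗ (X^ p ⊖ oneP))      ≈⟨ ≋-sym (≋-trans (⊗-congˡ (X^ p ⊖ oneP) (⊗-comm Φ₃ q)) (⊗-assoc q Φ₃ _)) ⟩
      (Φ₃ ⊗ q) ⊗ (X^ p ⊖ oneP)      ≈⟨ ⊗-congˡ (X^ p ⊖ oneP) Φ₃⊗q≋ ⟩
      Φ₃[X^ p ] ⊗ (X^ p ⊖ oneP)     ≈⟨ Φ₃[X^p]-⊗-[X^p-1] p ⟩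
      X^ (3 ℕ.* p) ⊖ oneP           ∎)

open ClosedForms

open import Data.Nat using (ℕ; zero; suc; _+_; _∸_; _≤_; _<_; _*_; _/_; _%_; z≤n; s≤s)
import Data.Nat.Properties as ℕ
open import Data.Nat.DivMod using (m≡m%n+[m/n]*n; +-distrib-/; m<n⇒m/n≡0; m*n/n≡m; m<n⇒m%n≡m; m*n%n≡0)
open import Data.Nat.Divisibility using (_∣_)
open import Data.Nat.Primality using (Prime; prime⇒irreducible)
open import Tactic.RingSolver using (solve-∀)

low-coefficients : ∀ p Q N m → (Φ₃ ⊗ Q) ≋ Φ₃[X^ p ] → m ≤ p → m ≤ 3 * suc N → ZeroBelow m (Q ⊖ recipΦ₃ N)
low-coefficients p Q N m Φ₃⊗Q≋ m≤p m≤3N+3 =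
  zeroBelow-Φ₃-cancel m (Q ⊖ recipΦ₃ N) (zeroBelow-resp-≋ (≋-sym Φ₃⊗difference≋)
    (zeroBelow-⊕ (X^ (3 * suc N)) (X^ p ⊕ X^ (p + p))
      (zeroBelow-mono (X^ (3 * suc N)) m≤3N+3 (zeroBelow-X^ (3 * suc N)))
      (zeroBelow-⊕ (X^ p) (X^ (p + p))
        (zeroBelow-mono (X^ p) m≤p (zeroBelow-X^ p))
        (zeroBelow-mono (X^ (p + p)) (ℕ.≤-trans m≤p (ℕ.m≤m+n p p)) (zeroBelow-X^ (p + p))))))
  where
  difference : ∀ φ q r y z w → ((φ ⊗ q) ≋ (oneP ⊕ y ⊕ z)) → ((φ ⊗ r) ≋ (oneP ⊖ w)) →
               (φ ⊗ (q ⊖ r)) ≋ (w ⊕ (y ⊕ z))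
  difference φ q r y z w φq≋ φr≋ =
    ≋-trans (distrib φ q r) (≋-trans (⊖-cong φq≋ φr≋) (cancel y z w))
    where
    distrib : ∀ φ q r → (φ ⊗ (q ⊖ r)) ≋ (φ ⊗ q ⊖ φ ⊗ r)
    distrib = solve-∀ ℤ[x]-solver
    cancel : ∀ y z w → ((oneP ⊕ y ⊕ z) ⊖ (oneP ⊖ w)) ≋ (w ⊕ (y ⊕ z))
    cancel = solve-∀ ℤ[x]-solver
  Φ₃⊗difference≋ : (Φ₃ ⊗ (Q ⊖ recipΦ₃ N)) ≋ (X^ (3 * suc N) ⊕ (X^ p ⊕ X^ (p + p)))
  Φ₃⊗difference≋ = difference Φ₃ Q (recipΦ₃ N) (X^ p) (X^ (p + p)) (X^ (3 * suc N)) Φ₃⊗Q≋ (Φ₃-⊗-recipΦ₃ N)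

trunc-recipΦ₃ : ∀ p Q N i → (Φ₃ ⊗ Q) ≋ Φ₃[X^ p ] → suc i ≤ p → suc (3 * N) ≤ i → i ≤ 2 + 3 * N →
                trunc (suc i) Q ≈ₚ recipΦ₃ N
trunc-recipΦ₃ p Q N i Φ₃⊗Q≋ 1+i≤p 3N+1≤i i≤3N+2 =
  trunc-≈ₚ (suc i) Q (recipΦ₃ N)
    (low-coefficients p Q N (suc i) Φ₃⊗Q≋ 1+i≤p (subst (suc i ≤_) (sym (ℕ.*-suc 3 N)) (s≤s i≤3N+2)))
    (zeroFrom-mono (recipΦ₃ N) (s≤s 3N+1≤i) (zeroFrom-recipΦ₃ N))

trunc-recipΦ₃+X^ : ∀ p Q N → (Φ₃ ⊗ Q) ≋ Φ₃[X^ p ] → suc (3 * suc N) ≤ p →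
                   trunc (suc (3 * suc N)) Q ≈ₚ (recipΦ₃ N ⊕ X^ (3 * suc N))
trunc-recipΦ₃+X^ p Q N Φ₃⊗Q≋ 1+i≤p =
  trunc-≈ₚ (suc i) Q (recipΦ₃ N ⊕ X^ i)
    (zeroBelow-resp-≋ (≋-sym difference≋) (zeroBelow-⊕ (Q ⊖ recipΦ₃ (suc N)) (negP (X^ (suc i)))
      (low-coefficients p Q (suc N) (suc i) Φ₃⊗Q≋ 1+i≤p i+1≤3N+6)
      (zeroBelow-negP (X^ (suc i)) (zeroBelow-X^ (suc i)))))
    (zeroFrom-⊕ (recipΦ₃ N) (X^ i)
      (zeroFrom-mono (recipΦ₃ N) 3N+2≤i+1 (zeroFrom-recipΦ₃ N))
      (zeroFrom-X^ i))
  where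
  i = 3 * suc N
  i+1≤3N+6 : suc i ≤ 3 * suc (suc N)
  i+1≤3N+6 = subst (suc i ≤_) (sym (ℕ.*-suc 3 (suc N))) (ℕ.m≤n+m (suc i) 2)
  3N+2≤i+1 : suc (suc (3 * N)) ≤ suc i
  3N+2≤i+1 = s≤s (subst (suc (3 * N) ≤_) (sym (ℕ.*-suc 3 N)) (ℕ.m≤n+m (suc (3 * N)) 2))
  regroup : ∀ q r s y z → r ≋ (s ⊕ y ⊖ z) → (q ⊖ (s ⊕ y)) ≋ ((q ⊖ r) ⊖ z)
  regroup q r s y z r≋ = ≋-trans (rebracket q s y z) (⊖-cong (⊖-cong (≋-refl {q}) (≋-sym r≋)) (≋-refl {z}))
    where
    rebracket : ∀ q s y z → (q ⊖ (s ⊕ y)) ≋ ((q ⊖ (s ⊕ y ⊖ z)) ⊖ z)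
    rebracket = solve-∀ ℤ[x]-solver
  difference≋ : (Q ⊖ (recipΦ₃ N ⊕ X^ i)) ≋ ((Q ⊖ recipΦ₃ (suc N)) ⊖ X^ (suc i))
  difference≋ = regroup Q (recipΦ₃ (suc N)) (recipΦ₃ N) (X^ i) (X^ (suc i)) (recipΦ₃-suc N)

[m+k*3]/3≡k : ∀ m k → m < 3 → (m + k * 3) / 3 ≡ k
[m+k*3]/3≡k m k m<3 = trans (+-distrib-/ m (k * 3) remainders<3) (cong₂ _+_ (m<n⇒m/n≡0 m<3) (m*n/n≡m k 3))
  where
  remainders<3 : m % 3 + k * 3 % 3 < 3
  remainders<3 = subst (_< 3) (sym (trans (cong₂ _+_ (m<n⇒m%n≡m m<3) (m*n%n≡0 k 3)) (ℕ.+-identityʳ m))) m<3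

multiple-of-3 : ∀ i → 1 ≤ i → i % 3 ≡ 0 → i ≡ 3 * suc ((i ∸ 1) / 3)
multiple-of-3 i 1≤i i%3≡0 with i / 3 | m≡m%n+[m/n]*n i 3
... | zero  | i≡ = ⊥-elim (ℕ.<⇒≢ 1≤i (sym (trans i≡ (cong (_+ 0) i%3≡0))))
... | suc k | i≡ = trans i≡3k+3 (trans (ℕ.*-comm (suc k) 3) (cong (λ n → 3 * suc n) (sym [i-1]/3≡k)))
  where
  i≡3k+3 : i ≡ suc k * 3
  i≡3k+3 = trans i≡ (cong (_+ suc k * 3) i%3≡0)
  [i-1]/3≡k : (i ∸ 1) / 3 ≡ k
  [i-1]/3≡k = trans (cong (λ j → (j ∸ 1) / 3) i≡3k+3) ([m+k*3]/3≡k 2 k (s≤s (s≤s (s≤s z≤n))))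

residue-bounds : ∀ i → i % 3 ≡ 1 ⊎ i % 3 ≡ 2 → suc (3 * (i / 3)) ≤ i × i ≤ 2 + 3 * (i / 3)
residue-bounds i r with i % 3 | i / 3 | m≡m%n+[m/n]*n i 3 | r
... | _ | k | refl | inj₁ refl = ℕ.≤-reflexive (cong suc (ℕ.*-comm 3 k)) , s≤s (ℕ.≤-trans (ℕ.≤-reflexive (ℕ.*-comm k 3)) (ℕ.n≤1+n _))
... | _ | k | refl | inj₂ refl = s≤s (ℕ.≤-trans (ℕ.≤-reflexive (ℕ.*-comm 3 k)) (ℕ.n≤1+n _)) , ℕ.≤-reflexive (cong (2 +_) (ℕ.*-comm k 3))

3∤prime : ∀ {p} → Prime p → 3 < p → ¬ 3 ∣ p
3∤prime p-prime 3<p 3∣p with prime⇒irreducible p-prime 3∣p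
... | inj₂ refl = ℕ.<-irrefl refl 3<p

lemma3p11 : (p₂ : ℕ) → Prime p₂ → 3 < p₂ →
    (i : ℕ) → 1 ≤ i → i ≤ p₂ ∸ 2 →
      (i % 3 ≡ 0 →
        trunc (suc i) (Φ (3 * p₂))
          ≈ₚ (oneP ⊖ X^ 1) ⊗ sumTo ((i ∸ 1) / 3) (λ j → X^ (3 * j)) ⊕ X^ i)
      × (i % 3 ≡ 1 ⊎ i % 3 ≡ 2 →
        trunc (suc i) (Φ (3 * p₂))
          ≈ₚ (oneP ⊖ X^ 1) ⊗ sumTo (i / 3) (λ j → X^ (3 * j)))
lemma3p11 p₂ p-prime 3<p i 1≤i i≤p-2 = multiple , non-multiple
  where
  Q = Φ (3 * p₂)
  Φ₃⊗Q≋ : (Φ₃ ⊗ Q) ≋ Φ₃[X^ p₂ ]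
  Φ₃⊗Q≋ = let q , Φ₃⊗q≋ = Φ₃-divides-Φ₃[X^p] p₂ 3<p (3∤prime p-prime 3<p) in
    ≋-trans (⊗-congʳ Φ₃ (Φ-3p p₂ q p-prime 3<p Φ₃⊗q≋)) Φ₃⊗q≋
  1+i≤p : suc i ≤ p₂
  1+i≤p = ℕ.≤-trans (s≤s i≤p-2) (ℕ.∸-monoʳ-< (s≤s z≤n) (ℕ.<⇒≤ (ℕ.<-trans (s≤s (s≤s (s≤s z≤n))) 3<p)))
  multiple : i % 3 ≡ 0 → trunc (suc i) Q ≈ₚ recipΦ₃ ((i ∸ 1) / 3) ⊕ X^ i
  multiple i%3≡0 = subst (λ j → trunc (suc j) Q ≈ₚ recipΦ₃ N ⊕ X^ j) (sym i≡)
    (trunc-recipΦ₃+X^ p₂ Q N Φ₃⊗Q≋ (subst (λ j → suc j ≤ p₂) i≡ 1+i≤p))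
    where
    N = (i ∸ 1) / 3
    i≡ = multiple-of-3 i 1≤i i%3≡0
  non-multiple : i % 3 ≡ 1 ⊎ i % 3 ≡ 2 → trunc (suc i) Q ≈ₚ recipΦ₃ (i / 3)
  non-multiple r = let lower , upper = residue-bounds i r in trunc-recipΦ₃ p₂ Q (i / 3) i Φ₃⊗Q≋ 1+i≤p lower upper
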